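{- For each positive integer $n$ there is a multiplicative function $f_n:\mathbb{N}\to\mathbb{N}$ satisfying $f_n(p^{k-1})\le f_n(p^k)$ for every prime $p$ and integer $k\ge1$, such that the set of $f_n$-practical numbers has asymptotic density $1-\frac{\varphi(n)}{n}$, where $\varphi$ is Euler's totient function.
   Context: $\mathbb{N}$ denotes the positive integers. For multiplicative $f$, $S_f(m)=\sum_{d\mid m} f(d)$, and a positive integer $m$ is $f$-practical if every positive integer $r\le S_f(m)$ can be written as $r=\sum_{d\in\mathcal{D}} f(d)$ for some set $\mathcal{D}$ of divisors of $m$. -}

module Defs where

open import Data.Nat using (ℕ; zero; suc; _+_; _*_; _∸_; _^_; _≤_; NonZero)
open import Data.Nat.Divisibility using (_∣_; _∣?_)
open import Data.Nat.GCD using (gcd)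
open import Data.Nat.Primality using (Prime)
open import Data.Nat.Coprimality using (Coprime)
open import Data.Nat.ListAction using (sum)
open import Data.List using (List; []; _∷_; _++_; map; filter; length)
open import Data.List.Relation.Unary.All using (All)
open import Data.List.Relation.Unary.Unique.Propositional using (Unique)
open import Data.Product using (Σ; _×_; ∃)
open import Data.Integer using (ℤ; +_)
open import Data.Rational using (ℚ; _/_; _-_; ∣_∣; _<_; 0ℚ; 1ℚ)
open import Relation.Binary.PropositionalEquality using (_≡_)
open import Relation.Nullary using (Dec; yes; no)
open import Relation.Unary using (Decidable)
open import Data.Nat using (_≟_)

range1 : ℕ → List ℕ
range1 zero    = []
range1 (suc n) = range1 n ++ (suc n ∷ [])

divisors : ℕ → List ℕ
divisors m = filter (λ d → d ∣? m) (range1 m)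

S : (ℕ → ℕ) → ℕ → ℕ
S f m = sum (map f (divisors m))

Multiplicative : (ℕ → ℕ) → Set
Multiplicative f =
  (f 1 ≡ 1) ×
  (∀ a b → 1 ≤ a → 1 ≤ b → Coprime a b → f (a * b) ≡ f a * f b)

PositiveValued : (ℕ → ℕ) → Set
PositiveValued f = ∀ m → 1 ≤ m → 1 ≤ f m

Practical : (ℕ → ℕ) → ℕ → Set
Practical f m =
  (1 ≤ m) ×
  (∀ r → 1 ≤ r → r ≤ S f m →
     Σ (List ℕ) λ D → Unique D × All (_∣ m) D × (sum (map f D) ≡ r))

countUpTo : {P : ℕ → Set} → Decidable P → ℕ → ℕ
countUpTo P? x = length (filter P? (range1 x))

φ : ℕ → ℕ
φ n = length (filter (λ k → gcd k n ≟ 1) (range1 n))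

HasDensity : {P : ℕ → Set} → Decidable P → ℚ → Set
HasDensity P? δ =
  ∀ (ε : ℚ) → 0ℚ < ε →
    ∃ λ N → ∀ (x : ℕ) → N ≤ x → .{{_ : NonZero x}} →
      ∣ (+ countUpTo P? x / x) - δ ∣ < ε

{-# OPTIONS --safe #-}
module Submission where

-- Let ω(d) count the primes dividing d but not n, and take f = 3^ω. If m > 1 is coprime to n,
-- every divisor d ≠ 1 of m has f(d) ≥ 3, so 2 ≤ S_f(m) is not a sum of distinct f(d). If a prime p
-- divides both m and n, multiplying or dividing by p pairs every divisor of m with another one of
-- the same weight; this gives f(d) ≤ 1 + Σ {f(e) : e ∣ m, f(e) < f(d)} for all d ∣ m, and Brown's
-- criterion makes every integer up to S_f(m) a sum of distinct f(d). So the f-practical numbers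
-- are 1 and the m with gcd(m, n) > 1; up to x there are x + 1 minus the number of k ≤ x coprime
-- to n, and that number is n-periodic with φ(n) per period, giving density 1 − φ(n)/n.

open import Data.Bool.Base using (if_then_else_)
open import Data.Empty using (⊥-elim)
open import Data.Integer using (ℤ; +_; +[1+_]; +0; -[1+_])
import Data.Integer as ℤ
import Data.Integer.Properties as ℤ
import Data.Integer.Tactic.RingSolver as ℤ-Solver
import Data.Nat.Tactic.RingSolver as ℕ-Solver
open import Data.List using (List; []; _∷_; _++_; map; filter; length)
open import Data.List.Properties using (map-++; filter-++; length-++; filter-≐; filter-all)
open import Data.List.Membership.Propositional using (_∈_; _∉_)
open import Data.List.Membership.Propositional.Properties using (∈-++⁻; ∈-++⁺ˡ; ∈-++⁺ʳ; ∈-filter⁺; ∈-filter⁻)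
open import Data.List.Relation.Unary.All as All using (All; []; _∷_)
open import Data.List.Relation.Unary.All.Properties using (all-filter)
open import Data.List.Relation.Unary.AllPairs using ([]; _∷_)
open import Data.List.Relation.Unary.Any using (here; there)
open import Data.List.Relation.Unary.Unique.Propositional using (Unique)
import Data.List.Relation.Unary.Unique.Propositional.Properties as Unique
open import Data.Nat hiding (_/_)
import Data.Nat as ℕ
open import Data.Nat.Properties
open import Data.Nat.Coprimality using (Coprime; coprime?; gcd≡1⇒coprime)
open import Data.Nat.Divisibility
open import Data.Nat.DivMod using (_%_; m%n<n; m≡m%n+[m/n]*n)
open import Data.Nat.GCD using (gcd; gcd[m,n]∣m; gcd[m,n]∣n; gcd[m,n]≢0; gcd-greatest; gcd-zeroˡ)
open import Data.Nat.Induction using (<-rec)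
open import Data.Nat.ListAction using (sum)
open import Data.Nat.ListAction.Properties using (sum-++)
open import Data.Nat.Primality using (Prime; prime?; prime⇒nonZero; prime⇒nonTrivial; prime⇒irreducible; euclidsLemma)
open import Data.Nat.Primality.Factorisation using (factorise)
open import Data.Product using (Σ; ∃; ∃₂; _×_; _,_; proj₁; proj₂)
open import Data.Rational using (ℚ; mkℚ; _/_; _-_; 0ℚ; 1ℚ; toℚᵘ)
import Data.Rational as ℚ
open import Data.Rational.Properties using (toℚᵘ-fromℚᵘ; toℚᵘ-homo-+; toℚᵘ-homo‿-; toℚᵘ-homo-∣-∣; toℚᵘ-cancel-<)
open import Data.Rational.Unnormalised using (ℚᵘ; mkℚᵘ; ↥_; ↧ₙ_)
import Data.Rational.Unnormalised as ℚᵘ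
import Data.Rational.Unnormalised.Properties as ℚᵘ
open import Data.Sum using (_⊎_; inj₁; inj₂; [_,_]; [_,_]′)
import Data.Sum as Sum
open import Function.Base using (_∘_; id)
open import Relation.Binary.PropositionalEquality hiding ([_])
open import Relation.Nullary using (¬_; yes; no; does; contradiction)
open import Relation.Nullary.Decidable using (_×-dec_; _⊎-dec_; ¬?; map′)
open import Relation.Unary using (Decidable; _⊆_; _≐_; _∪_; _⊥′_)
open import Algebra.Properties.CommutativeSemigroup +-commutativeSemigroup using (x∙yz≈y∙xz)
open import Defs

-- Counting on [1, x]

count : {P : ℕ → Set} → Decidable P → ℕ → ℕ
count P? zero    = zero
count P? (suc x) = if does (P? (suc x)) then suc (count P? x) else count P? x

module _ {P : ℕ → Set} (P? : Decidable P) where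

  countUpTo≡count : ∀ x → countUpTo P? x ≡ count P? x
  countUpTo≡count zero    = refl
  countUpTo≡count (suc x) = begin
    length (filter P? (range1 x ++ suc x ∷ []))
      ≡⟨ cong length (filter-++ P? (range1 x) (suc x ∷ [])) ⟩
    length (filter P? (range1 x) ++ filter P? (suc x ∷ []))
      ≡⟨ length-++ (filter P? (range1 x)) ⟩
    countUpTo P? x + length (filter P? (suc x ∷ []))
      ≡⟨ cong (_+ length (filter P? (suc x ∷ []))) (countUpTo≡count x) ⟩
    count P? x + length (filter P? (suc x ∷ []))
      ≡⟨ last ⟩
    count P? (suc x) ∎
    where
    open ≡-Reasoning
    last : count P? x + length (filter P? (suc x ∷ [])) ≡ count P? (suc x)
    last with P? (suc x)
    ... | yes _ = +-comm (count P? x) 1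
    ... | no _  = +-identityʳ (count P? x)

  count≤ : ∀ x → count P? x ≤ x
  count≤ zero = z≤n
  count≤ (suc x) with P? (suc x)
  ... | yes _ = s≤s (count≤ x)
  ... | no _  = m≤n⇒m≤1+n (count≤ x)

  count-stable : ∀ {K} → (∀ {q} → P q → q ≤ K) → ∀ {x} → K ≤ x → count P? x ≡ count P? K
  count-stable P≤K {zero} z≤n = refl
  count-stable P≤K {suc x} K≤1+x with m≤n⇒m<n∨m≡n K≤1+x
  ... | inj₂ refl = refl
  ... | inj₁ (s≤s K≤x) with P? (suc x)
  ...   | yes p = contradiction (P≤K p) (<⇒≱ (s≤s K≤x))
  ...   | no _  = count-stable P≤K K≤x

  ∈⇒count>0 : ∀ {q x} → 1 ≤ q → q ≤ x → P q → 1 ≤ count P? x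
  ∈⇒count>0 {x = zero} () z≤n _
  ∈⇒count>0 {x = suc x} 1≤q q≤1+x p with P? (suc x)
  ... | yes _ = s≤s z≤n
  ... | no ¬p with m≤n⇒m<n∨m≡n q≤1+x
  ...   | inj₂ refl = contradiction p ¬p
  ...   | inj₁ (s≤s q≤x) = ∈⇒count>0 1≤q q≤x p

  count>0⇒∃ : ∀ x → 1 ≤ count P? x → ∃ P
  count>0⇒∃ (suc x) c with P? (suc x)
  ... | yes p = suc x , p
  ... | no _  = count>0⇒∃ x c

  count≡0 : ∀ x → (∀ {q} → 1 ≤ q → q ≤ x → ¬ P q) → count P? x ≡ 0
  count≡0 zero _ = refl
  count≡0 (suc x) none with P? (suc x)
  ... | yes p = contradiction p (none (s≤s z≤n) ≤-refl)
  ... | no _  = count≡0 x λ 1≤q q≤x → none 1≤q (m≤n⇒m≤1+n q≤x)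

  count≡1 : ∀ {a x} → 1 ≤ a → a ≤ x → P a → (∀ {q} → P q → q ≡ a) → count P? x ≡ 1
  count≡1 {x = zero} () z≤n _ _
  count≡1 {a} {suc x} 1≤a a≤1+x pa only-a with P? (suc x)
  ... | yes p = cong suc (count≡0 x λ _ q≤x pq → 1+n≰n (subst (_≤ x) (trans (only-a pq) (sym (only-a p))) q≤x))
  ... | no ¬p with m≤n⇒m<n∨m≡n a≤1+x
  ...   | inj₂ refl = contradiction pa ¬p
  ...   | inj₁ (s≤s a≤x) = count≡1 1≤a a≤x pa only-a

module _ {P Q : ℕ → Set} (P? : Decidable P) (Q? : Decidable Q) where

  count-mono : P ⊆ Q → ∀ x → count P? x ≤ count Q? x
  count-mono P⊆Q zero = z≤n
  count-mono P⊆Q (suc x) with P? (suc x) | Q? (suc x)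
  ... | yes _ | yes _  = s≤s (count-mono P⊆Q x)
  ... | yes p | no ¬q  = contradiction (P⊆Q p) ¬q
  ... | no _  | yes _  = m≤n⇒m≤1+n (count-mono P⊆Q x)
  ... | no _  | no _   = count-mono P⊆Q x

  count-cover : (∀ {k} → 1 ≤ k → P k ⊎ Q k) → (∀ {k} → P k → Q k → k ≡ 1) → P 1 → Q 1 →
    ∀ x → count P? (suc x) + count Q? (suc x) ≡ suc (suc x)
  count-cover _ _ p1 q1 zero with P? 1 | Q? 1
  ... | yes _ | yes _ = refl
  ... | no ¬p | _     = contradiction p1 ¬p
  ... | yes _ | no ¬q = contradiction q1 ¬q
  count-cover cover meet≡1 p1 q1 (suc x)
    with P? (suc (suc x)) | Q? (suc (suc x)) | count-cover cover meet≡1 p1 q1 x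
  ... | yes p | yes q | _  = contradiction (meet≡1 p q) λ ()
  ... | yes _ | no _  | ih = cong suc ih
  ... | no _  | yes _ | ih = trans (+-suc _ _) (cong suc ih)
  ... | no ¬p | no ¬q | _  = ⊥-elim ([ ¬p , ¬q ]′ (cover (s≤s z≤n)))

count-cong : ∀ {P Q : ℕ → Set} (P? : Decidable P) (Q? : Decidable Q) → P ≐ Q →
  ∀ x → count P? x ≡ count Q? x
count-cong P? Q? (P⊆Q , Q⊆P) x = ≤-antisym (count-mono P? Q? P⊆Q x) (count-mono Q? P? Q⊆P x)

count-partition : ∀ {P Q R : ℕ → Set} (P? : Decidable P) (Q? : Decidable Q) (R? : Decidable R) →
  R ≐ P ∪ Q → P ⊥′ Q → ∀ x → count R? x ≡ count P? x + count Q? x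
count-partition P? Q? R? _ _ zero = refl
count-partition P? Q? R? R≐P∪Q P⊥Q (suc x)
  with R? (suc x) | P? (suc x) | Q? (suc x) | count-partition P? Q? R? R≐P∪Q P⊥Q x
... | _      | yes p  | yes q  | _  = ⊥-elim (P⊥Q _ (p , q))
... | yes _  | yes _  | no _   | ih = cong suc ih
... | yes _  | no _   | yes _  | ih = trans (cong suc ih) (sym (+-suc _ _))
... | yes r  | no ¬p  | no ¬q  | _  = ⊥-elim ([ ¬p , ¬q ] (proj₁ R≐P∪Q r))
... | no ¬r  | yes p  | no _   | _  = contradiction (proj₂ R≐P∪Q (inj₁ p)) ¬r
... | no ¬r  | no _   | yes q  | _  = contradiction (proj₂ R≐P∪Q (inj₂ q)) ¬r
... | no _   | no _   | no _   | ih = ih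

module _ {P : ℕ → Set} (P? : Decidable P) {n : ℕ} (periodic : P ≐ (P ∘ (_+ n))) where

  count-+period : ∀ y → count P? (y + n) ≡ count P? y + count P? n
  count-+period zero = refl
  count-+period (suc y) with P? (suc (y + n)) | P? (suc y)
  ... | yes _ | yes _ = cong suc (count-+period y)
  ... | no _  | no _  = count-+period y
  ... | yes p | no ¬p = contradiction (proj₂ periodic p) ¬p
  ... | no ¬p | yes p = contradiction (proj₁ periodic p) ¬p

  count-periods : ∀ q s → count P? (s + q * n) ≡ count P? s + q * count P? n
  count-periods zero s = trans (cong (count P?) (+-identityʳ s)) (sym (+-identityʳ _))
  count-periods (suc q) s = begin
    count P? (s + (n + q * n))        ≡⟨ cong (count P?) (x∙yz≈y∙xz s n (q * n)) ⟩
    count P? (n + (s + q * n))        ≡⟨ cong (count P?) (+-comm n (s + q * n)) ⟩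
    count P? (s + q * n + n)          ≡⟨ count-+period (s + q * n) ⟩
    count P? (s + q * n) + count P? n ≡⟨ cong (_+ count P? n) (count-periods q s) ⟩
    count P? s + q * count P? n + count P? n ≡⟨ +-assoc (count P? s) _ _ ⟩
    count P? s + (q * count P? n + count P? n) ≡⟨ cong (λ k → count P? s + k) (+-comm (q * count P? n) _) ⟩
    count P? s + suc q * count P? n   ∎
    where open ≡-Reasoning

∣⇒≥1 : ∀ {d m} → 1 ≤ m → d ∣ m → 1 ≤ d
∣⇒≥1 {zero} 1≤m 0∣m = contradiction (0∣⇒≡0 0∣m) (≢-sym (<⇒≢ 1≤m))
∣⇒≥1 {suc _} _ _ = s≤s z≤n

∣⇒≤-pos : ∀ {d m} → 1 ≤ m → d ∣ m → d ≤ m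
∣⇒≤-pos 1≤m = ∣⇒≤ {{>-nonZero 1≤m}}

∈-range1⁺ : ∀ {d} x → 1 ≤ d → d ≤ x → d ∈ range1 x
∈-range1⁺ zero () z≤n
∈-range1⁺ (suc x) 1≤d d≤1+x with m≤n⇒m<n∨m≡n d≤1+x
... | inj₁ (s≤s d≤x) = ∈-++⁺ˡ (∈-range1⁺ x 1≤d d≤x)
... | inj₂ refl      = ∈-++⁺ʳ (range1 x) (here refl)

∈-range1⁻ : ∀ {d} x → d ∈ range1 x → 1 ≤ d × d ≤ x
∈-range1⁻ (suc x) d∈ with ∈-++⁻ (range1 x) d∈
... | inj₁ d∈x with ∈-range1⁻ x d∈x
...   | 1≤d , d≤x = 1≤d , m≤n⇒m≤1+n d≤x
∈-range1⁻ (suc x) d∈ | inj₂ (here refl) = s≤s z≤n , ≤-refl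

range1-unique : ∀ x → Unique (range1 x)
range1-unique zero    = []
range1-unique (suc x) = Unique.++⁺ (range1-unique x) ([] ∷ [])
  λ { (1+x∈ , here refl) → 1+n≰n (proj₂ (∈-range1⁻ x 1+x∈)) }

∈-divisors⁺ : ∀ {d m} → 1 ≤ m → d ∣ m → d ∈ divisors m
∈-divisors⁺ {m = m} 1≤m d∣m =
  ∈-filter⁺ (_∣? m) (∈-range1⁺ m (∣⇒≥1 1≤m d∣m) (∣⇒≤-pos 1≤m d∣m)) d∣m

∈-divisors⁻ : ∀ {d m} → d ∈ divisors m → 1 ≤ d × d ∣ m
∈-divisors⁻ {m = m} d∈ with ∈-filter⁻ (_∣? m) {xs = range1 m} d∈
... | d∈range , d∣m = proj₁ (∈-range1⁻ m d∈range) , d∣m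

divisors-unique : ∀ m → Unique (divisors m)
divisors-unique m = Unique.filter⁺ (_∣? m) (range1-unique m)

-- Complete lists of weights

module _ (g : ℕ → ℕ) (k : ℕ) where

  ≤-suc-split : (λ y → g y ≤ suc k) ≐ (λ y → g y ≡ suc k) ∪ (λ y → g y ≤ k)
  ≤-suc-split = (λ gy≤1+k → [ inj₂ ∘ ≤-pred , inj₁ ]′ (m≤n⇒m<n∨m≡n gy≤1+k))
              , [ ≤-reflexive , m≤n⇒m≤1+n ]′

  ≡suc⊥≤ : (λ y → g y ≡ suc k) ⊥′ (λ y → g y ≤ k)
  ≡suc⊥≤ _ (gy≡1+k , gy≤k) = 1+n≰n (subst (_≤ k) gy≡1+k gy≤k)

  <-suc-split : (λ y → g y < suc k) ≐ (λ y → g y ≡ k) ∪ (λ y → g y < k)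
  <-suc-split = (λ gy<1+k → [ inj₂ , inj₁ ]′ (m≤n⇒m<n∨m≡n (≤-pred gy<1+k)))
              , [ (λ gy≡k → s≤s (≤-reflexive gy≡k)) , m<n⇒m<1+n ]′

  ≡⊥< : (λ y → g y ≡ k) ⊥′ (λ y → g y < k)
  ≡⊥< _ (gy≡k , gy<k) = <-irrefl gy≡k gy<k

module SubsetSums (w : ℕ → ℕ) where

  weight : List ℕ → ℕ
  weight L = sum (map w L)

  weight-++ : ∀ A B → weight (A ++ B) ≡ weight A + weight B
  weight-++ A B = trans (cong sum (map-++ w A B)) (sum-++ (map w A) (map w B))

  ∈⇒≤weight : ∀ {x} L → x ∈ L → w x ≤ weight L
  ∈⇒≤weight (y ∷ L) (here refl) = m≤m+n (w y) (weight L)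
  ∈⇒≤weight (y ∷ L) (there x∈L) = ≤-trans (∈⇒≤weight L x∈L) (m≤n+m (weight L) (w y))

  distinct∈⇒≤weight : ∀ {a b} L → Unique L → a ∈ L → b ∈ L → a ≢ b → w a + w b ≤ weight L
  distinct∈⇒≤weight (y ∷ L) _ (here refl) (here refl) a≢b = contradiction refl a≢b
  distinct∈⇒≤weight (y ∷ L) _ (here refl) (there b∈L) _ = +-monoʳ-≤ (w y) (∈⇒≤weight L b∈L)
  distinct∈⇒≤weight {a} (y ∷ L) _ (there a∈L) (here refl) _ =
    ≤-trans (≤-reflexive (+-comm (w a) (w y))) (+-monoʳ-≤ (w y) (∈⇒≤weight L a∈L))
  distinct∈⇒≤weight (y ∷ L) (_ ∷ uL) (there a∈L) (there b∈L) a≢b =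
    ≤-trans (distinct∈⇒≤weight L uL a∈L b∈L a≢b) (m≤n+m (weight L) (w y))

  weightless : ∀ {L} → All (λ y → w y ≡ 0) L → weight L ≡ 0
  weightless []             = refl
  weightless (wy≡0 ∷ wL≡0) = cong₂ _+_ wy≡0 (weightless wL≡0)

  weight-partition : ∀ {P Q R : ℕ → Set} (P? : Decidable P) (Q? : Decidable Q) (R? : Decidable R) →
    R ≐ P ∪ Q → P ⊥′ Q → ∀ L → weight (filter R? L) ≡ weight (filter P? L) + weight (filter Q? L)
  weight-partition P? Q? R? _ _ [] = refl
  weight-partition P? Q? R? R≐P∪Q P⊥Q (y ∷ L)
    with R? y | P? y | Q? y | weight-partition P? Q? R? R≐P∪Q P⊥Q L
  ... | _      | yes p  | yes q  | _  = ⊥-elim (P⊥Q _ (p , q))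
  ... | yes _  | yes _  | no _   | ih = trans (cong (λ k → w y + k) ih) (sym (+-assoc (w y) (weight (filter P? L)) (weight (filter Q? L))))
  ... | yes _  | no _   | yes _  | ih = trans (cong (λ k → w y + k) ih) (x∙yz≈y∙xz (w y) (weight (filter P? L)) (weight (filter Q? L)))
  ... | yes r  | no ¬p  | no ¬q  | _  = ⊥-elim ([ ¬p , ¬q ] (proj₁ R≐P∪Q r))
  ... | no ¬r  | yes p  | no _   | _  = contradiction (proj₂ R≐P∪Q (inj₁ p)) ¬r
  ... | no ¬r  | no _   | yes q  | _  = contradiction (proj₂ R≐P∪Q (inj₂ q)) ¬r
  ... | no _   | no _   | no _   | ih = ih

  Complete : List ℕ → Set
  Complete B = ∀ r → r ≤ weight B → Σ (List ℕ) λ D → Unique D × All (_∈ B) D × weight D ≡ r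

  weight≡0⇒complete : ∀ {B} → weight B ≡ 0 → Complete B
  weight≡0⇒complete weight≡0 r r≤ with subst (r ≤_) weight≡0 r≤
  ... | z≤n = [] , [] , [] , refl

  complete-⊆ : ∀ {A B} → Complete A → (∀ {x} → x ∈ A → x ∈ B) → weight A ≡ weight B → Complete B
  complete-⊆ complete A⊆B weightA≡weightB r r≤ with complete r (subst (r ≤_) (sym weightA≡weightB) r≤)
  ... | D , uD , D⊆A , weightD≡r = D , uD , All.map A⊆B D⊆A , weightD≡r

  complete-∷ : ∀ {e B} → Complete B → e ∉ B → w e ≤ suc (weight B) → Complete (e ∷ B)
  complete-∷ {e} {B} complete e∉B we≤ r r≤ with r ≤? weight B
  ... | yes r≤B with complete r r≤B
  ...   | D , uD , D⊆B , weightD≡r = D , uD , All.map there D⊆B , weightD≡r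
  complete-∷ {e} {B} complete e∉B we≤ r r≤ | no r≰B
    with complete (r ∸ w e) (m≤n+o⇒m∸n≤o r (w e) r≤)
  ... | D , uD , D⊆B , weightD≡r-we =
    e ∷ D , All.map (λ { d∈B refl → e∉B d∈B }) D⊆B ∷ uD , here refl ∷ All.map there D⊆B ,
    trans (cong (λ k → w e + k) weightD≡r-we) (m+[n∸m]≡n (≤-trans we≤ (≰⇒> r≰B)))

  complete-++ : ∀ {E B} → Complete B → Unique E → (∀ {e} → e ∈ E → e ∉ B) →
    (∀ {e} → e ∈ E → w e ≤ suc (weight B)) → Complete (E ++ B)
  complete-++ {[]} complete _ _ _ = complete
  complete-++ {e ∷ E} {B} complete (e∉E ∷ uE) E∉B E≤ =
    complete-∷ (complete-++ complete uE (E∉B ∘ there) (E≤ ∘ there))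
      (λ e∈E++B → [ (λ e∈E → All.lookup e∉E e∈E refl) , E∉B (here refl) ] (∈-++⁻ E e∈E++B))
      (≤-trans (E≤ (here refl)) (s≤s (≤-trans (m≤n+m (weight B) (weight E)) (≤-reflexive (sym (weight-++ E B))))))

  -- Brown's criterion; L need not be sorted, as only strictly lighter elements are summed.
  brown⇒complete : ∀ L → Unique L →
    (∀ {x} → x ∈ L → w x ≤ suc (weight (filter (λ y → w y <? w x) L))) → Complete L
  brown⇒complete L uL brown =
    complete-⊆ (complete-upTo (weight L)) (proj₁ ∘ ∈-filter⁻ _) (cong weight (filter-all _ (All.tabulate (∈⇒≤weight L))))
    where
    upTo : ℕ → List ℕ
    upTo T = filter (λ y → w y ≤? T) L

    complete-upTo : ∀ T → Complete (upTo T)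
    complete-upTo zero = weight≡0⇒complete (weightless (All.map n≤0⇒n≡0 (all-filter (λ y → w y ≤? 0) L)))
    complete-upTo (suc T) = complete-⊆
      (complete-++ (complete-upTo T) (Unique.filter⁺ _ uL) heavy∉light heavy≤)
      heavy++light⊆ (trans (weight-++ heavy (upTo T)) (sym (weight-partition _ _ _ (≤-suc-split w T) (≡suc⊥≤ w T) L)))
      where
      heavy : List ℕ
      heavy = filter (λ y → w y ≟ suc T) L

      heavy∉light : ∀ {e} → e ∈ heavy → e ∉ upTo T
      heavy∉light e∈heavy e∈light =
        ≡suc⊥≤ w T _ (proj₂ (∈-filter⁻ _ {xs = L} e∈heavy) , proj₂ (∈-filter⁻ _ {xs = L} e∈light))

      heavy≤ : ∀ {e} → e ∈ heavy → w e ≤ suc (weight (upTo T))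
      heavy≤ {e} e∈heavy with ∈-filter⁻ (λ y → w y ≟ suc T) {xs = L} e∈heavy
      ... | e∈L , we≡1+T = ≤-trans (brown e∈L) (s≤s (≤-reflexive (cong weight
            (filter-≐ (λ y → w y <? w e) (λ y → w y ≤? T)
               ((λ {y} wy<we → ≤-pred (subst (w y <_) we≡1+T wy<we))
               , (λ {y} wy≤T → subst (w y <_) (sym we≡1+T) (s≤s wy≤T))) L))))

      heavy++light⊆ : ∀ {x} → x ∈ heavy ++ upTo T → x ∈ upTo (suc T)
      heavy++light⊆ x∈ with ∈-++⁻ heavy x∈
      ... | inj₁ x∈heavy = let x∈L , wx≡ = ∈-filter⁻ _ {xs = L} x∈heavy in ∈-filter⁺ _ x∈L (≤-reflexive wx≡)
      ... | inj₂ x∈light = let x∈L , wx≤ = ∈-filter⁻ _ {xs = L} x∈light in ∈-filter⁺ _ x∈L (m≤n⇒m≤1+n wx≤)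

prime⇒≥2 : ∀ {p} → Prime p → 2 ≤ p
prime⇒≥2 {p} p-prime = nonTrivial⇒n>1 p {{prime⇒nonTrivial p-prime}}

prime≢1 : ∀ {p} → Prime p → p ≢ 1
prime≢1 p-prime p≡1 = <⇒≢ (prime⇒≥2 p-prime) (sym p≡1)

prime∣prime⇒≡ : ∀ {r q} → Prime r → Prime q → r ∣ q → r ≡ q
prime∣prime⇒≡ r-prime q-prime r∣q with prime⇒irreducible q-prime r∣q
... | inj₁ r≡1 = contradiction r≡1 (prime≢1 r-prime)
... | inj₂ r≡q  = r≡q

prime∣^⇒≡ : ∀ {r q} k → Prime r → Prime q → r ∣ q ^ k → r ≡ q
prime∣^⇒≡ zero r-prime _ r∣1 = contradiction (∣1⇒≡1 r∣1) (prime≢1 r-prime)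
prime∣^⇒≡ {q = q} (suc k) r-prime q-prime r∣q^1+k with euclidsLemma q (q ^ k) r-prime r∣q^1+k
... | inj₁ r∣q   = prime∣prime⇒≡ r-prime q-prime r∣q
... | inj₂ r∣q^k = prime∣^⇒≡ k r-prime q-prime r∣q^k

∃prime∣ : ∀ {d} → 2 ≤ d → ∃ λ q → Prime q × q ∣ d
∃prime∣ {d@(suc _)} 2≤d with factorise d
... | record { factors = q ∷ qs ; isFactorisation = d≡Πqs ; factorsPrime = q-prime ∷ _ } =
  q , q-prime , subst (q ∣_) (sym d≡Πqs) (m∣m*n _)
... | record { factors = [] ; isFactorisation = refl } with 2≤d
...   | s≤s ()

prime∤⇒*∣ : ∀ {p s m} → Prime p → ¬ p ∣ s → p ∣ m → s ∣ m → p * s ∣ m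
prime∤⇒*∣ {p} {s} p-prime p∤s p∣m (divides k refl) with euclidsLemma k s p-prime p∣m
... | inj₁ p∣k = *-monoˡ-∣ s p∣k
... | inj₂ p∣s = contradiction p∣s p∤s

factor-out : ∀ {q} → 2 ≤ q → ∀ d → 1 ≤ d → ∃₂ λ k s → d ≡ q ^ k * s × ¬ q ∣ s
factor-out {q} 2≤q = <-rec _ step
  where
  step : ∀ d → (∀ {d′} → d′ < d → 1 ≤ d′ → ∃₂ λ k s → d′ ≡ q ^ k * s × ¬ q ∣ s) →
    1 ≤ d → ∃₂ λ k s → d ≡ q ^ k * s × ¬ q ∣ s
  step d rec 1≤d with q ∣? d
  ... | no q∤d = 0 , d , sym (+-identityʳ d) , q∤d
  ... | yes (divides d′ d≡d′q) with rec d′<d 1≤d′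
    where
    1≤d′ : 1 ≤ d′
    1≤d′ = ∣⇒≥1 1≤d (divides q (trans d≡d′q (*-comm d′ q)))
    d′<d : d′ < d
    d′<d = subst (d′ <_) (sym d≡d′q) (m<m*n d′ q {{>-nonZero 1≤d′}} 2≤q)
  ... | k , s , d′≡q^ks , q∤s = suc k , s , d≡ , q∤s
    where
    open ≡-Reasoning
    d≡ : d ≡ q ^ suc k * s
    d≡ = begin
      d             ≡⟨ d≡d′q ⟩
      d′ * q        ≡⟨ *-comm d′ q ⟩
      q * d′        ≡⟨ cong (q *_) d′≡q^ks ⟩
      q * (q ^ k * s) ≡⟨ *-assoc q (q ^ k) s ⟨
      q ^ suc k * s ∎

gcd[m+n,n]≡gcd[m,n] : ∀ m n → gcd (m + n) n ≡ gcd m n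
gcd[m+n,n]≡gcd[m,n] m n = ∣-antisym
  (gcd-greatest (∣m+n∣m⇒∣n (subst (gcd (m + n) n ∣_) (+-comm m n) (gcd[m,n]∣m (m + n) n)) (gcd[m,n]∣n (m + n) n))
                (gcd[m,n]∣n (m + n) n))
  (gcd-greatest (∣m∣n⇒∣m+n (gcd[m,n]∣m m n) (gcd[m,n]∣n m n)) (gcd[m,n]∣n m n))

-- Density from an error bound

∣-∣≤ : ∀ {a b u v B} → a + u ≡ b + v → u ≤ B → v ≤ B → ∣ a - b ∣ ≤ B
∣-∣≤ {a} {b} {u} {v} {B} a+u≡b+v u≤B v≤B = begin
  ∣ a - b ∣         ≡⟨ ∣m+n-m+o∣≡∣n-o∣ u a b ⟨
  ∣ u + a - u + b ∣ ≡⟨ cong₂ ∣_-_∣ (trans (+-comm u a) a+u≡b+v) (+-comm u b) ⟩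
  ∣ b + v - b + u ∣ ≡⟨ ∣m+n-m+o∣≡∣n-o∣ b v u ⟩
  ∣ v - u ∣         ≤⟨ ∣m-n∣≤m⊔n v u ⟩
  v ⊔ u             ≤⟨ ⊔-lub v≤B u≤B ⟩
  B                 ∎
  where open ≤-Reasoning

toℚᵘ-−-cong : ∀ {p q p′ q′} → toℚᵘ p ℚᵘ.≃ p′ → toℚᵘ q ℚᵘ.≃ q′ → toℚᵘ (p - q) ℚᵘ.≃ p′ ℚᵘ.- q′
toℚᵘ-−-cong {p} {q} p≃ q≃ =
  ℚᵘ.≃-trans (toℚᵘ-homo-+ p (ℚ.- q)) (ℚᵘ.+-cong p≃ (ℚᵘ.≃-trans (toℚᵘ-homo‿- q) (ℚᵘ.-‿cong q≃)))

toℚᵘ-/ : ∀ (i : ℤ) d → toℚᵘ (i / suc d) ℚᵘ.≃ mkℚᵘ i d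
toℚᵘ-/ i d = toℚᵘ-fromℚᵘ (mkℚᵘ i d)

∣+m-+n∣≡∣m-n∣ : ∀ m n → ℤ.∣ + m ℤ.- + n ∣ ≡ ∣ m - n ∣
∣+m-+n∣≡∣m-n∣ m n with ≤-total m n
... | inj₁ m≤n = trans (cong ℤ.∣_∣ (ℤ.m-n≡m⊖n m n)) (trans (ℤ.∣⊖∣-≤ m≤n) (sym (m≤n⇒∣m-n∣≡n∸m m≤n)))
... | inj₂ n≤m = trans (cong ℤ.∣_∣ (ℤ.m-n≡m⊖n m n))
  (trans (ℤ.∣m⊖n∣≡∣n⊖m∣ m n) (trans (ℤ.∣⊖∣-≤ n≤m) (sym (m≤n⇒∣n-m∣≡n∸m n≤m))))

positive-numerator : ∀ (ε : ℚ) → 0ℚ ℚ.< ε → ∃ λ e → ℚ.numerator ε ≡ +[1+ e ]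
positive-numerator (mkℚ +[1+ e ] _ _) _ = e , refl
positive-numerator (mkℚ +0 _ _) (ℚ.*<* (ℤ.+<+ ()))
positive-numerator (mkℚ -[1+ _ ] _ _) (ℚ.*<* ())

module _ (a c x n : ℕ) where

  private
    diff : ℚᵘ
    diff = mkℚᵘ (+ a) x ℚᵘ.- (mkℚᵘ (+ 1) 0 ℚᵘ.- mkℚᵘ (+ c) n)

    toℚᵘ≃diff : toℚᵘ ℚ.∣ + a / suc x - (1ℚ - + c / suc n) ∣ ℚᵘ.≃ ℚᵘ.∣ diff ∣
    toℚᵘ≃diff = ℚᵘ.≃-trans (toℚᵘ-homo-∣-∣ _) (ℚᵘ.∣-∣-cong
      (toℚᵘ-−-cong (toℚᵘ-/ (+ a) x) (toℚᵘ-−-cong (toℚᵘ-/ (+ 1) 0) (toℚᵘ-/ (+ c) n))))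

    ↥diff≡ : ↥ diff ≡ + (a * suc n + c * suc x) ℤ.- + (suc n * suc x)
    ↥diff≡ = trans (ring (+ a) (+ suc n) (+ suc x) (+ c)) (cong₂ ℤ._-_
      (trans (cong₂ ℤ._+_ (sym (ℤ.pos-* a (suc n))) (sym (ℤ.pos-* c (suc x)))) (sym (ℤ.pos-+ (a * suc n) (c * suc x))))
      (sym (ℤ.pos-* (suc n) (suc x))))
      where
      ring : ∀ (a n x c : ℤ) →
        a ℤ.* (+ 1 ℤ.* n) ℤ.+ ℤ.- (+ 1 ℤ.* n ℤ.+ ℤ.- c ℤ.* + 1) ℤ.* x ≡ (a ℤ.* n ℤ.+ c ℤ.* x) ℤ.- n ℤ.* x
      ring = ℤ-Solver.solve-∀

    ↧diff≡ : ↧ₙ diff ≡ suc x * suc n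
    ↧diff≡ = cong (λ k → suc x * suc k) (+-identityʳ n)

    ∣↥diff∣≡ : ℤ.∣ ↥ diff ∣ ≡ ∣ a * suc n + c * suc x - suc n * suc x ∣
    ∣↥diff∣≡ = trans (cong ℤ.∣_∣ ↥diff≡) (∣+m-+n∣≡∣m-n∣ (a * suc n + c * suc x) (suc n * suc x))

  ∣a/x-[1-c/n]∣<ε : ∀ (ε : ℚ) → 0ℚ ℚ.< ε →
    ∣ a * suc n + c * suc x - suc n * suc x ∣ ≤ suc n * suc n →
    suc n * ℚ.denominatorℕ ε < suc x →
    ℚ.∣ + a / suc x - (1ℚ - + c / suc n) ∣ ℚ.< ε
  ∣a/x-[1-c/n]∣<ε ε@(mkℚ _ d _) ε>0 dist≤ n·d<x with positive-numerator ε ε>0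
  ... | e , refl = toℚᵘ-cancel-< (ℚᵘ.<-respˡ-≃ (ℚᵘ.≃-sym toℚᵘ≃diff) (ℚᵘ.*<*
        (subst₂ ℤ._<_ (ℤ.pos-* ℤ.∣ ↥ diff ∣ (suc d)) (ℤ.pos-* (suc e) (↧ₙ diff)) (ℤ.+<+ ∣↥diff∣·d<e·↧diff))))
    where
    open ≤-Reasoning
    ∣↥diff∣·d<e·↧diff : ℤ.∣ ↥ diff ∣ * suc d < suc e * ↧ₙ diff
    ∣↥diff∣·d<e·↧diff = begin-strict
      ℤ.∣ ↥ diff ∣ * suc d      ≤⟨ *-monoˡ-≤ (suc d) (≤-trans (≤-reflexive ∣↥diff∣≡) dist≤) ⟩
      suc n * suc n * suc d     ≡⟨ *-assoc (suc n) (suc n) (suc d) ⟩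
      suc n * (suc n * suc d)   ≡⟨ cong (suc n *_) (*-comm (suc n) (suc d)) ⟩
      suc n * (suc d * suc n)   ≡⟨ *-assoc (suc n) (suc d) (suc n) ⟨
      suc n * suc d * suc n     <⟨ *-monoˡ-< (suc n) n·d<x ⟩
      suc x * suc n             ≤⟨ m≤n*m (suc x * suc n) (suc e) ⟩
      suc e * (suc x * suc n)   ≡⟨ cong (suc e *_) ↧diff≡ ⟨
      suc e * ↧ₙ diff           ∎

hasDensity-1-c/n : ∀ {P : ℕ → Set} (P? : Decidable P) c n .{{_ : NonZero n}} →
  (∀ x → 1 ≤ x → ∣ countUpTo P? x * n + c * x - n * x ∣ ≤ n * n) →
  HasDensity P? (1ℚ - + c / n)
hasDensity-1-c/n P? c (suc n) error≤ ε ε>0 = suc (suc n * ℚ.denominatorℕ ε) , estimate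
  where
  estimate : ∀ x → suc (suc n * ℚ.denominatorℕ ε) ≤ x → .{{_ : NonZero x}} →
    ℚ.∣ + countUpTo P? x / x - (1ℚ - + c / suc n) ∣ ℚ.< ε
  estimate (suc x) N≤x = ∣a/x-[1-c/n]∣<ε (countUpTo P? (suc x)) c x n ε ε>0 (error≤ (suc x) (s≤s z≤n)) N≤x

-- The weight 3 ^ ω

module _ (n : ℕ) where

  CoprimePrimeFactor : ℕ → ℕ → Set
  CoprimePrimeFactor d q = Prime q × Coprime q n × q ∣ d

  coprimePrimeFactor? : ∀ d → Decidable (CoprimePrimeFactor d)
  coprimePrimeFactor? d q = prime? q ×-dec coprime? q n ×-dec q ∣? d

  withDivisor : ∀ {d e q} → CoprimePrimeFactor d q → q ∣ e → CoprimePrimeFactor e q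
  withDivisor (q-prime , q⊥n , _) q∣e = q-prime , q⊥n , q∣e

  coprimePrimeFactor-∣ : ∀ {d e} → d ∣ e → CoprimePrimeFactor d ⊆ CoprimePrimeFactor e
  coprimePrimeFactor-∣ d∣e q-factor@(_ , _ , q∣d) = withDivisor q-factor (∣-trans q∣d d∣e)

  ω : ℕ → ℕ
  ω d = count (coprimePrimeFactor? d) d

  ω≡count : ∀ {d x} → 1 ≤ d → d ≤ x → ω d ≡ count (coprimePrimeFactor? d) x
  ω≡count 1≤d d≤x = sym (count-stable (coprimePrimeFactor? _) (λ (_ , _ , q∣d) → ∣⇒≤-pos 1≤d q∣d) d≤x)

  ω[1]≡0 : ω 1 ≡ 0
  ω[1]≡0 = count≡0 (coprimePrimeFactor? 1) 1 λ _ q≤1 (q-prime , _) → <⇒≱ (prime⇒≥2 q-prime) q≤1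

  ∃⇒ω>0 : ∀ {d q} → 1 ≤ d → CoprimePrimeFactor d q → 1 ≤ ω d
  ∃⇒ω>0 1≤d q-factor@(q-prime , _ , q∣d) =
    ∈⇒count>0 (coprimePrimeFactor? _) (≤-trans (s≤s z≤n) (prime⇒≥2 q-prime)) (∣⇒≤-pos 1≤d q∣d) q-factor

  ω-* : ∀ {a b} → 1 ≤ a → 1 ≤ b → Coprime a b → ω (a * b) ≡ ω a + ω b
  ω-* {a} {b} 1≤a 1≤b a⊥b = begin
    ω (a * b)
      ≡⟨ count-partition (coprimePrimeFactor? a) (coprimePrimeFactor? b) (coprimePrimeFactor? (a * b)) split disjoint (a * b) ⟩
    count (coprimePrimeFactor? a) (a * b) + count (coprimePrimeFactor? b) (a * b)
      ≡⟨ cong₂ _+_ (ω≡count 1≤a (m≤m*n a b {{>-nonZero 1≤b}})) (ω≡count 1≤b (m≤n*m b a {{>-nonZero 1≤a}})) ⟨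
    ω a + ω b ∎
    where
    open ≡-Reasoning
    split : CoprimePrimeFactor (a * b) ≐ CoprimePrimeFactor a ∪ CoprimePrimeFactor b
    split = (λ q-factor@(q-prime , _ , q∣ab) → Sum.map (withDivisor q-factor) (withDivisor q-factor) (euclidsLemma a b q-prime q∣ab))
          , [ coprimePrimeFactor-∣ (m∣m*n b) , coprimePrimeFactor-∣ (n∣m*n a) ]
    disjoint : CoprimePrimeFactor a ⊥′ CoprimePrimeFactor b
    disjoint _ ((q-prime , _ , q∣a) , (_ , _ , q∣b)) = prime≢1 q-prime (a⊥b (q∣a , q∣b))

  ω-mono-∣ : ∀ {a b} → 1 ≤ b → a ∣ b → ω a ≤ ω b
  ω-mono-∣ {a} {b} 1≤b a∣b = begin
    ω a                                 ≡⟨ ω≡count (∣⇒≥1 1≤b a∣b) (∣⇒≤-pos 1≤b a∣b) ⟩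
    count (coprimePrimeFactor? a) b     ≤⟨ count-mono (coprimePrimeFactor? a) (coprimePrimeFactor? b) (coprimePrimeFactor-∣ a∣b) b ⟩
    ω b                                 ∎
    where open ≤-Reasoning

  ω[p*d]≡ω[d] : ∀ {p d} → Prime p → p ∣ n → 1 ≤ d → ω (p * d) ≡ ω d
  ω[p*d]≡ω[d] {p} {d} p-prime p∣n 1≤d = begin
    ω (p * d)                             ≡⟨ count-cong (coprimePrimeFactor? (p * d)) (coprimePrimeFactor? d) same (p * d) ⟩
    count (coprimePrimeFactor? d) (p * d) ≡⟨ ω≡count 1≤d (m≤n*m d p {{prime⇒nonZero p-prime}}) ⟨
    ω d                                   ∎
    where
    open ≡-Reasoning
    same : CoprimePrimeFactor (p * d) ≐ CoprimePrimeFactor d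
    same = (λ q-factor@(q-prime , q⊥n , q∣pd) → withDivisor q-factor
                ([ (λ q∣p → contradiction (q⊥n (∣-refl , subst (_∣ n) (sym (prime∣prime⇒≡ q-prime p-prime q∣p)) p∣n))
                                          (prime≢1 q-prime))
                 , id ] (euclidsLemma p d q-prime q∣pd)))
         , coprimePrimeFactor-∣ (n∣m*n p)

  ω[q^k*s]≡1+ω[s] : ∀ {q s} k → Prime q → Coprime q n → ¬ q ∣ s → 1 ≤ s → ω (q ^ suc k * s) ≡ suc (ω s)
  ω[q^k*s]≡1+ω[s] {q} {s} k q-prime q⊥n q∤s 1≤s = begin
    ω d                                                 ≡⟨ count-partition (_≟ q) (coprimePrimeFactor? s) (coprimePrimeFactor? d) split disjoint d ⟩
    count (_≟ q) d + count (coprimePrimeFactor? s) d   ≡⟨ cong₂ _+_ (count≡1 (_≟ q) (≤-trans (s≤s z≤n) (prime⇒≥2 q-prime)) (∣⇒≤-pos 1≤d q∣d) refl (λ r≡q → r≡q))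
                                                                     (sym (ω≡count 1≤s (∣⇒≤-pos 1≤d s∣d))) ⟩
    suc (ω s)                                           ∎
    where
    open ≡-Reasoning
    d : ℕ
    d = q ^ suc k * s
    1≤d : 1 ≤ d
    1≤d = *-mono-≤ (m^n>0 q {{prime⇒nonZero q-prime}} (suc k)) 1≤s
    q∣d : q ∣ d
    q∣d = ∣-trans (m∣m*n (q ^ k)) (m∣m*n s)
    s∣d : s ∣ d
    s∣d = n∣m*n (q ^ suc k)
    split : CoprimePrimeFactor d ≐ (_≡ q) ∪ CoprimePrimeFactor s
    split = (λ r-factor@(r-prime , _ , r∣d) → Sum.map (prime∣^⇒≡ (suc k) r-prime q-prime) (withDivisor r-factor)
                                                 (euclidsLemma (q ^ suc k) s r-prime r∣d))
          , [ (λ { refl → q-prime , q⊥n , q∣d }) , coprimePrimeFactor-∣ s∣d ]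
    disjoint : (_≡ q) ⊥′ CoprimePrimeFactor s
    disjoint _ (refl , (_ , _ , q∣s)) = q∤s q∣s

  ω-drop : ∀ {d} → 1 ≤ d → 1 ≤ ω d → ∃ λ s → s ∣ d × suc (ω s) ≡ ω d
  ω-drop {d} 1≤d 1≤ωd with count>0⇒∃ (coprimePrimeFactor? d) d 1≤ωd
  ... | q , q-prime , q⊥n , q∣d with factor-out (prime⇒≥2 q-prime) d 1≤d
  ...   | zero    , s , d≡s , q∤s = contradiction (subst (q ∣_) (trans d≡s (*-identityˡ s)) q∣d) q∤s
  ...   | suc k , s , d≡q^ks , q∤s =
    s , divides (q ^ suc k) d≡q^ks ,
    trans (sym (ω[q^k*s]≡1+ω[s] k q-prime q⊥n q∤s (∣⇒≥1 1≤d (divides (q ^ suc k) d≡q^ks)))) (cong ω (sym d≡q^ks))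

  f : ℕ → ℕ
  f d = 3 ^ ω d

  f[1]≡1 : f 1 ≡ 1
  f[1]≡1 = cong (3 ^_) ω[1]≡0

  f-multiplicative : Multiplicative f
  f-multiplicative = f[1]≡1 , λ a b 1≤a 1≤b a⊥b →
    trans (cong (3 ^_) (ω-* 1≤a 1≤b a⊥b)) (^-distribˡ-+-* 3 (ω a) (ω b))

  f-positive : PositiveValued f
  f-positive d _ = m^n>0 3 (ω d)

  f-mono-prime-power : ∀ p k → Prime p → f (p ^ k) ≤ f (p ^ suc k)
  f-mono-prime-power p k p-prime =
    ^-monoʳ-≤ 3 (ω-mono-∣ (m^n>0 p {{prime⇒nonZero p-prime}} (suc k)) (n∣m*n p))

  f<⇔ω< : ∀ x → (λ y → ω y < ω x) ≐ (λ y → f y < f x)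
  f<⇔ω< x = ^-monoʳ-< 3 (s≤s (s≤s z≤n))
          , λ {y} fy<fx → ≰⇒> λ ωx≤ωy → <⇒≱ fy<fx (^-monoʳ-≤ 3 ωx≤ωy)

  open SubsetSums f

  -- The f-practical numbers

  complete⇒practical : ∀ {m} → 1 ≤ m → Complete (divisors m) → Practical f m
  complete⇒practical 1≤m complete = 1≤m , λ r _ r≤S →
    let D , uD , D⊆divisors , weightD≡r = complete r r≤S
    in  D , uD , All.map (proj₂ ∘ ∈-divisors⁻) D⊆divisors , weightD≡r

  practical[1] : Practical f 1
  practical[1] = complete⇒practical ≤-refl (brown⇒complete (divisors 1) (divisors-unique 1) f≤1+)
    where
    f≤1+ : ∀ {x} → x ∈ divisors 1 → f x ≤ suc (weight (filter (λ y → f y <? f x) (divisors 1)))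
    f≤1+ x∈ with ∣1⇒≡1 (proj₂ (∈-divisors⁻ x∈))
    ... | refl = ≤-trans (≤-reflexive f[1]≡1) (s≤s z≤n)

  module _ {m p} (1≤m : 1 ≤ m) (p-prime : Prime p) (p∣m : p ∣ m) (p∣n : p ∣ n) where

    partner : ∀ {s} → s ∈ divisors m → ∃ λ t → t ∈ divisors m × t ≢ s × ω t ≡ ω s
    partner {s} s∈ with ∈-divisors⁻ s∈ | p ∣? s
    ... | 1≤s , s∣m | yes (divides t s≡tp) =
      t , ∈-divisors⁺ 1≤m (∣-trans t∣s s∣m) , <⇒≢ t<s ,
      trans (sym (ω[p*d]≡ω[d] p-prime p∣n 1≤t)) (cong ω (trans (*-comm p t) (sym s≡tp)))
      where
      t∣s : t ∣ s
      t∣s = divides p (trans s≡tp (*-comm t p))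
      1≤t : 1 ≤ t
      1≤t = ∣⇒≥1 1≤s t∣s
      t<s : t < s
      t<s = subst (t <_) (sym s≡tp) (m<m*n t p {{>-nonZero 1≤t}} (prime⇒≥2 p-prime))
    ... | 1≤s , s∣m | no p∤s =
      p * s , ∈-divisors⁺ 1≤m (prime∤⇒*∣ p-prime p∤s p∣m s∣m) , ≢-sym (<⇒≢ s<ps) , ω[p*d]≡ω[d] p-prime p∣n 1≤s
      where
      s<ps : s < p * s
      s<ps = subst (s <_) (*-comm s p) (m<m*n s p {{>-nonZero 1≤s}} (prime⇒≥2 p-prime))

    -- A divisor with ω = j + 1 has a divisor s with ω s = j; s and its partner both weigh 3 ^ j,
    -- which together with the induction hypothesis covers 3 ^ (j + 1) = 3 ^ j + 2 · 3 ^ j.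
    3^j≤1+lighter : ∀ j {d} → d ∈ divisors m → ω d ≡ j →
      3 ^ j ≤ suc (weight (filter (λ y → ω y <? j) (divisors m)))
    3^j≤1+lighter zero _ _ = s≤s z≤n
    3^j≤1+lighter (suc j) {d} d∈ ωd≡1+j with ∈-divisors⁻ d∈
    ... | 1≤d , d∣m with ω-drop 1≤d (subst (1 ≤_) (sym ωd≡1+j) (s≤s z≤n))
    ... | s , s∣d , 1+ωs≡ωd with partner (∈-divisors⁺ 1≤m (∣-trans s∣d d∣m))
    ... | t , t∈ , t≢s , ωt≡ωs = begin
      3 ^ j + (3 ^ j + (3 ^ j + 0))
        ≡⟨ cong (λ k → 3 ^ j + k) (cong₂ _+_ (cong (3 ^_) (sym ωs≡j)) (trans (+-identityʳ (3 ^ j)) (cong (3 ^_) (sym ωt≡j)))) ⟩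
      3 ^ j + (f s + f t)
        ≤⟨ +-mono-≤ (3^j≤1+lighter j s∈ ωs≡j) (distinct∈⇒≤weight level-j (Unique.filter⁺ _ (divisors-unique m))
                      (∈-filter⁺ (λ y → ω y ≟ j) s∈ ωs≡j) (∈-filter⁺ (λ y → ω y ≟ j) t∈ ωt≡j) (≢-sym t≢s)) ⟩
      suc (weight (filter (λ y → ω y <? j) L)) + weight level-j
        ≡⟨ cong suc (+-comm (weight (filter (λ y → ω y <? j) L)) (weight level-j)) ⟩
      suc (weight level-j + weight (filter (λ y → ω y <? j) L))
        ≡⟨ cong suc (weight-partition _ _ _ (<-suc-split ω j) (≡⊥< ω j) L) ⟨
      suc (weight (filter (λ y → ω y <? suc j) L)) ∎
      where
      open ≤-Reasoning
      L : List ℕ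
      L = divisors m
      level-j : List ℕ
      level-j = filter (λ y → ω y ≟ j) L
      s∈ : s ∈ L
      s∈ = ∈-divisors⁺ 1≤m (∣-trans s∣d d∣m)
      ωs≡j : ω s ≡ j
      ωs≡j = suc-injective (trans 1+ωs≡ωd ωd≡1+j)
      ωt≡j : ω t ≡ j
      ωt≡j = trans ωt≡ωs ωs≡j

    shared-prime⇒practical : Practical f m
    shared-prime⇒practical = complete⇒practical 1≤m (brown⇒complete (divisors m) (divisors-unique m) brown)
      where
      brown : ∀ {x} → x ∈ divisors m → f x ≤ suc (weight (filter (λ y → f y <? f x) (divisors m)))
      brown {x} x∈ = subst (λ L → f x ≤ suc (weight L))
        (filter-≐ (λ y → ω y <? ω x) (λ y → f y <? f x) (f<⇔ω< x) (divisors m))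
        (3^j≤1+lighter (ω x) x∈ refl)

  module _ {m} (2≤m : 2 ≤ m) (m⊥n : Coprime m n) where

    private
      1≤m : 1 ≤ m
      1≤m = <⇒≤ 2≤m

      3≰2 : ¬ 3 ≤ 2
      3≰2 (s≤s (s≤s ()))

    3≤f : ∀ {d} → d ∣ m → d ≢ 1 → 3 ≤ f d
    3≤f {d} d∣m d≢1 with ∃prime∣ (≤∧≢⇒< (∣⇒≥1 1≤m d∣m) (≢-sym d≢1))
    ... | q , q-prime , q∣d = ^-monoʳ-≤ 3 (∃⇒ω>0 (∣⇒≥1 1≤m d∣m) (q-prime , q⊥n , q∣d))
      where
      q⊥n : Coprime q n
      q⊥n (i∣q , i∣n) = m⊥n (∣-trans i∣q (∣-trans q∣d d∣m) , i∣n)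

    weight≢2 : ∀ D → All (_∣ m) D → Unique D → weight D ≢ 2
    weight≢2 [] _ _ ()
    weight≢2 (d ∷ D) (d∣m ∷ D∣m) (d∉D ∷ _) weight≡2 with d ≟ 1
    ... | no d≢1  = 3≰2 (≤-trans (3≤f d∣m d≢1) (≤-trans (m≤m+n (f d) (weight D)) (≤-reflexive weight≡2)))
    ... | yes refl = only-1 D D∣m d∉D weight≡2
      where
      only-1 : ∀ D → All (_∣ m) D → All (1 ≢_) D → f 1 + weight D ≢ 2
      only-1 [] _ _ f1+0≡2 = contradiction (trans (cong (_+ 0) (sym f[1]≡1)) f1+0≡2) λ ()
      only-1 (e ∷ D) (e∣m ∷ _) (1≢e ∷ _) weight≡2 = 3≰2 (begin
        3                         ≤⟨ 3≤f e∣m (≢-sym 1≢e) ⟩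
        f e                       ≤⟨ m≤m+n (f e) (weight D) ⟩
        f e + weight D            ≤⟨ m≤n+m (f e + weight D) (f 1) ⟩
        f 1 + (f e + weight D)    ≡⟨ weight≡2 ⟩
        2                         ∎)
        where open ≤-Reasoning

    coprime⇒¬practical : ¬ Practical f m
    coprime⇒¬practical (_ , represent) with represent 2 (s≤s z≤n) 2≤S
      where
      2≤S : 2 ≤ S f m
      2≤S = ≤-trans (+-mono-≤ (f-positive 1 ≤-refl) (f-positive m 1≤m))
        (distinct∈⇒≤weight (divisors m) (divisors-unique m) (∈-divisors⁺ 1≤m (1∣ m)) (∈-divisors⁺ 1≤m ∣-refl) (<⇒≢ 2≤m))
    ... | D , uD , D∣m , weight≡2 = weight≢2 D D∣m uD weight≡2

  OneOrSharesFactor : ℕ → Set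
  OneOrSharesFactor m = 1 ≤ m × (m ≡ 1 ⊎ gcd m n ≢ 1)

  oneOrSharesFactor? : Decidable OneOrSharesFactor
  oneOrSharesFactor? m = (1 ≤? m) ×-dec ((m ≟ 1) ⊎-dec ¬? (gcd m n ≟ 1))

  practical≐oneOrSharesFactor : Practical f ≐ OneOrSharesFactor
  practical≐oneOrSharesFactor = ⇒ , ⇐
    where
    ⇒ : Practical f ⊆ OneOrSharesFactor
    ⇒ {m} practical@(1≤m , _) with m ≟ 1 | gcd m n ≟ 1
    ... | yes m≡1 | _        = 1≤m , inj₁ m≡1
    ... | no _    | no g≢1   = 1≤m , inj₂ g≢1
    ... | no m≢1  | yes g≡1  = contradiction practical (coprime⇒¬practical (≤∧≢⇒< 1≤m (≢-sym m≢1)) (gcd≡1⇒coprime g≡1))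
    ⇐ : OneOrSharesFactor ⊆ Practical f
    ⇐ (_ , inj₁ refl) = practical[1]
    ⇐ {m} (1≤m , inj₂ g≢1) with ∃prime∣ {gcd m n} (≤∧≢⇒< (n≢0⇒n>0 (gcd[m,n]≢0 m n (inj₁ (≢-sym (<⇒≢ 1≤m))))) (≢-sym g≢1))
    ... | p , p-prime , p∣g =
      shared-prime⇒practical 1≤m p-prime (∣-trans p∣g (gcd[m,n]∣m m n)) (∣-trans p∣g (gcd[m,n]∣n m n))

  practical? : Decidable (Practical f)
  practical? m = map′ (proj₂ practical≐oneOrSharesFactor) (proj₁ practical≐oneOrSharesFactor) (oneOrSharesFactor? m)

  coprimeTo? : Decidable (λ k → gcd k n ≡ 1)
  coprimeTo? k = gcd k n ≟ 1

  count-coprimeTo : ∀ q s → count coprimeTo? (s + q * n) ≡ count coprimeTo? s + q * φ n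
  count-coprimeTo q s = trans (count-periods coprimeTo? periodic q s)
    (cong (λ k → count coprimeTo? s + q * k) (sym (countUpTo≡count coprimeTo? n)))
    where
    periodic : (λ k → gcd k n ≡ 1) ≐ (λ k → gcd (k + n) n ≡ 1)
    periodic = (λ {k} g≡1 → trans (gcd[m+n,n]≡gcd[m,n] k n) g≡1)
             , (λ {k} g≡1 → trans (sym (gcd[m+n,n]≡gcd[m,n] k n)) g≡1)

  count-practical+count-coprimeTo : ∀ x → countUpTo practical? (suc x) + count coprimeTo? (suc x) ≡ suc (suc x)
  count-practical+count-coprimeTo x = trans
    (cong (_+ count coprimeTo? (suc x))
      (trans (countUpTo≡count practical? (suc x)) (count-cong practical? oneOrSharesFactor? practical≐oneOrSharesFactor (suc x))))
    (count-cover oneOrSharesFactor? coprimeTo? cover meet≡1 (≤-refl , inj₁ refl) (gcd-zeroˡ n) x)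
    where
    cover : ∀ {k} → 1 ≤ k → OneOrSharesFactor k ⊎ gcd k n ≡ 1
    cover {k} 1≤k with gcd k n ≟ 1
    ... | yes g≡1 = inj₂ g≡1
    ... | no g≢1  = inj₁ (1≤k , inj₂ g≢1)
    meet≡1 : ∀ {k} → OneOrSharesFactor k → gcd k n ≡ 1 → k ≡ 1
    meet≡1 (_ , inj₁ k≡1)  _   = k≡1
    meet≡1 (_ , inj₂ g≢1) g≡1 = contradiction g≡1 g≢1

  -- Write x = s + q n with s < n. Then A + (c + q φ(n)) = x + 1 for A the number of practical
  -- numbers up to x and c the number of k ≤ s coprime to n, so A n + φ(n) x deviates from n x
  -- by n + φ(n) s − n c, which is at most n² in absolute value.
  practical-count-error : .{{_ : NonZero n}} → ∀ x → 1 ≤ x →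
    ∣ countUpTo practical? x * n + φ n * x - n * x ∣ ≤ n * n
  practical-count-error (suc x) _ = ∣-∣≤ balance (*-monoʳ-≤ n (≤-trans c≤s (<⇒≤ s<n))) (begin
      n + φ n * s  ≤⟨ +-monoʳ-≤ n (*-monoˡ-≤ s φ≤n) ⟩
      n + n * s    ≡⟨ *-suc n s ⟨
      n * suc s    ≤⟨ *-monoʳ-≤ n s<n ⟩
      n * n        ∎)
    where
    open ≤-Reasoning
    A s q c : ℕ
    A = countUpTo practical? (suc x)
    s = suc x % n
    q = suc x ℕ./ n
    c = count coprimeTo? s
    s<n : s < n
    s<n = m%n<n (suc x) n
    c≤s : c ≤ s
    c≤s = count≤ coprimeTo? s
    φ≤n : φ n ≤ n
    φ≤n = subst (_≤ n) (sym (countUpTo≡count coprimeTo? n)) (count≤ coprimeTo? n)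
    x≡s+qn : suc x ≡ s + q * n
    x≡s+qn = m≡m%n+[m/n]*n (suc x) n
    regroup : ∀ A φ s q c n → A * n + φ * (s + q * n) + n * c ≡ (A + (c + q * φ)) * n + φ * s
    regroup = ℕ-Solver.solve-∀
    unfold : ∀ x n r → suc (suc x) * n + r ≡ n * suc x + (n + r)
    unfold = ℕ-Solver.solve-∀
    balance : A * n + φ n * suc x + n * c ≡ n * suc x + (n + φ n * s)
    balance = begin-equality
      A * n + φ n * suc x + n * c                   ≡⟨ cong (λ k → A * n + φ n * k + n * c) x≡s+qn ⟩
      A * n + φ n * (s + q * n) + n * c             ≡⟨ regroup A (φ n) s q c n ⟩
      (A + (c + q * φ n)) * n + φ n * s             ≡⟨ cong (λ k → (A + k) * n + φ n * s) (count-coprimeTo q s) ⟨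
      (A + count coprimeTo? (s + q * n)) * n + φ n * s ≡⟨ cong (λ k → (A + count coprimeTo? k) * n + φ n * s) x≡s+qn ⟨
      (A + count coprimeTo? (suc x)) * n + φ n * s  ≡⟨ cong (λ k → k * n + φ n * s) (count-practical+count-coprimeTo x) ⟩
      suc (suc x) * n + φ n * s                     ≡⟨ unfold x n (φ n * s) ⟩
      n * suc x + (n + φ n * s)                     ∎

lemma4p3 : (n : ℕ) → .{{_ : NonZero n}} →
    Σ (ℕ → ℕ) λ f →
      Multiplicative f × PositiveValued f ×
      (∀ p k → Prime p → f (p ^ k) ≤ f (p ^ suc k)) ×
      Σ (Decidable (Practical f)) λ dec →
        HasDensity dec (1ℚ - (+ φ n / n))
lemma4p3 n = f n , f-multiplicative n , f-positive n , f-mono-prime-power n , practical? n ,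
  hasDensity-1-c/n (practical? n) (φ n) n (practical-count-error n)
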